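{- Let $p$ be a prime with $p\equiv 2\pmod 3$ and let $d$ be an odd positive integer. Then there is no distributive Mendelsohn quasigroup of order $p^d$.
   Context: A Mendelsohn quasigroup is an idempotent quasigroup $(V,\circ)$ satisfying $x\circ(y\circ x)=y$ for all $x,y\in V$. A quasigroup is distributive if it is both left distributive, $x\circ(y\circ z)=(x\circ y)\circ(x\circ z)$, and right distributive, $(x\circ y)\circ z=(x\circ z)\circ(y\circ z)$, for all $x,y,z$. -}

module Defs where

open import Data.Nat using (ℕ)
open import Data.Fin using (Fin)
open import Data.Product using (_×_)
open import Relation.Binary.PropositionalEquality using (_≡_)
open import Function.Definitions using (Bijective)

-- A binary operation on a carrier of order n (carrier taken to be Fin n;
-- every finite set of size n is in bijection with Fin n).
Op : ℕ → Set
Op n = Fin n → Fin n → Fin n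

IsQuasigroupOp : {n : ℕ} → Op n → Set
IsQuasigroupOp {n} _∘_ =
  ((x : Fin n) → Bijective _≡_ _≡_ (λ y → x ∘ y)) ×
  ((x : Fin n) → Bijective _≡_ _≡_ (λ y → y ∘ x))

Idempotent : {n : ℕ} → Op n → Set
Idempotent {n} _∘_ = (x : Fin n) → x ∘ x ≡ x

IsMendelsohnQuasigroup : {n : ℕ} → Op n → Set
IsMendelsohnQuasigroup {n} _∘_ =
  IsQuasigroupOp _∘_ × Idempotent _∘_ ×
  ((x y : Fin n) → x ∘ (y ∘ x) ≡ y)

LeftDistributive : {n : ℕ} → Op n → Set
LeftDistributive {n} _∘_ = (x y z : Fin n) → x ∘ (y ∘ z) ≡ (x ∘ y) ∘ (x ∘ z)

RightDistributive : {n : ℕ} → Op n → Set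
RightDistributive {n} _∘_ = (x y z : Fin n) → (x ∘ y) ∘ z ≡ (x ∘ z) ∘ (y ∘ z)

IsDistributive : {n : ℕ} → Op n → Set
IsDistributive _∘_ = LeftDistributive _∘_ × RightDistributive _∘_

-- In a Mendelsohn quasigroup the
-- map (x , y) ↦ (y , x ∘ y) has order 3 and permutes the n (n − 1)
-- off-diagonal pairs without fixed points, so 3 ∣ n (n − 1); but p ≡ 2 and
-- d odd give p ^ d ≡ 2 (mod 3), and then 3 divides neither n nor n − 1.
module Submission where

open import Defs
open import Data.Nat using (ℕ; _^_; _%_; suc)
open import Data.Nat.Primality using (Prime)
open import Data.Product using (_×_)
open import Relation.Binary.PropositionalEquality using (_≡_)
open import Relation.Nullary using (¬_)

open import Data.Nat using (zero; _+_; _*_; _<_; s≤s; z≤n; NonZero)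
open import Data.Nat.Properties using (+-comm; *-identityʳ; m<n+m)
open import Data.Nat.DivMod using (%-distribˡ-*; %-distribˡ-+; [m+n]%n≡m%n)
open import Data.Nat.Divisibility using (_∣_; _∣0; ∣-refl; ∣m∣n⇒∣m+n; n∣m⇒m%n≡0)
open import Data.Nat.Induction using (<-wellFounded)
open import Data.Nat.Primality using (prime?; euclidsLemma)
open import Data.Fin using (Fin; punchIn; punchOut; _≟_)
open import Data.Fin.Properties using (punchInᵢ≢i; punchIn-punchOut; punchIn-injective)
open import Data.List using (List; []; _∷_; length; map; filter; cartesianProduct; allFin; _++_)
open import Data.List.Properties using (length-map; length-++; length-tabulate)
open import Data.List.Membership.Propositional using (_∈_; _∉_)
open import Data.List.Membership.Propositional.Properties
  using (∈-map⁺; ∈-map⁻; ∈-cartesianProduct⁺; ∈-allFin; ∈-filter⁺; ∈-filter⁻; ++-∈⇔)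
open import Data.List.Membership.Propositional.Properties.WithK using (unique∧set⇒bag)
open import Data.List.Relation.Binary.BagAndSetEquality using (∼bag⇒↭)
open import Data.List.Relation.Binary.Permutation.Propositional.Properties using (↭-length)
open import Data.List.Relation.Unary.Any using (here; there)
open import Data.List.Relation.Unary.All using ([]; _∷_)
open import Data.List.Relation.Unary.Unique.Propositional using (Unique; []; _∷_)
open import Data.List.Relation.Unary.Unique.Propositional.Properties
  using (++⁺; filter⁺; cartesianProduct⁺; allFin⁺) renaming (map⁺ to unique-map⁺)
open import Data.Product using (_,_; proj₁; proj₂)
open import Data.Product.Properties using (≡-dec)
open import Data.Sum using (inj₁; inj₂)
open import Function.Bundles using (_⇔_; mk⇔; Equivalence)
open import Function.Definitions using (Injective)
open import Induction.WellFounded using (Acc; acc)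
open import Relation.Binary.Definitions using (DecidableEquality)
open import Relation.Binary.PropositionalEquality using (_≢_; ≢-sym; refl; sym; trans; cong; cong₂; subst; module ≡-Reasoning)
open import Relation.Nullary.Decidable using (yes; no; from-yes)
open ≡-Reasoning

unique∧set⇒length≡ : {A : Set} {xs ys : List A} → Unique xs → Unique ys →
                     (∀ {v} → v ∈ xs ⇔ v ∈ ys) → length xs ≡ length ys
unique∧set⇒length≡ uxs uys xs≈ys = ↭-length (∼bag⇒↭ (unique∧set⇒bag uxs uys xs≈ys))

length-cartesianProduct : {A B : Set} (xs : List A) (ys : List B) →
                          length (cartesianProduct xs ys) ≡ length xs * length ys
length-cartesianProduct []       ys = refl
length-cartesianProduct (x ∷ xs) ys = begin
  length (map (x ,_) ys ++ cartesianProduct xs ys)   ≡⟨ length-++ (map (x ,_) ys) ⟩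
  length (map (x ,_) ys) + length (cartesianProduct xs ys)
    ≡⟨ cong₂ _+_ (length-map (x ,_) ys) (length-cartesianProduct xs ys) ⟩
  length ys + length xs * length ys                  ∎

module OrderThree {A : Set} (_≟_ : DecidableEquality A)
                  (f : A → A) (f³≡id : ∀ a → f (f (f a)) ≡ a) where

  open import Data.List.Membership.DecPropositional _≟_ using (_∈?_; _∉?_)

  orbit : A → List A
  orbit a = a ∷ f a ∷ f (f a) ∷ []

  f-injective : ∀ {a b} → f a ≡ f b → a ≡ b
  f-injective {a} {b} fa≡fb = begin
    a             ≡⟨ f³≡id a ⟨
    f (f (f a))   ≡⟨ cong (λ t → f (f t)) fa≡fb ⟩
    f (f (f b))   ≡⟨ f³≡id b ⟩
    b             ∎

  orbit-unique : ∀ {a} → f a ≢ a → Unique (orbit a)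
  orbit-unique {a} fa≢a =
    (≢-sym fa≢a ∷ a≢ffa ∷ []) ∷ ((λ fa≡ffa → fa≢a (sym (f-injective fa≡ffa))) ∷ []) ∷ [] ∷ []
    where
      a≢ffa : a ≢ f (f a)
      a≢ffa a≡ffa = fa≢a (trans (cong f a≡ffa) (f³≡id a))

  ∈-orbit-f⁻ : ∀ {a b} → f b ∈ orbit a → b ∈ orbit a
  ∈-orbit-f⁻ {a} (here fb≡a)                = there (there (here (f-injective (trans fb≡a (sym (f³≡id a))))))
  ∈-orbit-f⁻ (there (here fb≡fa))           = here (f-injective fb≡fa)
  ∈-orbit-f⁻ (there (there (here fb≡ffa)))  = there (here (f-injective fb≡ffa))

  record FreeOrbits (xs : List A) : Set where
    field
      unique    : Unique xs
      closed    : ∀ {b} → b ∈ xs → f b ∈ xs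
      fixedFree : ∀ {b} → b ∈ xs → f b ≢ b

  module _ {xs : List A} {a : A} (inv : FreeOrbits xs) (a∈xs : a ∈ xs) where
    open FreeOrbits inv

    outside : List A
    outside = filter (_∉? orbit a) xs

    ∈-outside⁻ : ∀ {b} → b ∈ outside → b ∈ xs × b ∉ orbit a
    ∈-outside⁻ = ∈-filter⁻ (_∉? orbit a) {xs = xs}

    outside-freeOrbits : FreeOrbits outside
    outside-freeOrbits = record
      { unique    = filter⁺ (_∉? orbit a) unique
      ; closed    = λ b∈ → let b∈xs , b∉orbit = ∈-outside⁻ b∈ in
                    ∈-filter⁺ (_∉? orbit a) (closed b∈xs) (λ fb∈orbit → b∉orbit (∈-orbit-f⁻ fb∈orbit))
      ; fixedFree = λ b∈ → fixedFree (proj₁ (∈-outside⁻ b∈))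
      }

    orbit⊆xs : ∀ {b} → b ∈ orbit a → b ∈ xs
    orbit⊆xs (here refl)                = a∈xs
    orbit⊆xs (there (here refl))        = closed a∈xs
    orbit⊆xs (there (there (here refl))) = closed (closed a∈xs)

    xs≈orbit++outside : ∀ {b} → b ∈ xs ⇔ b ∈ orbit a ++ outside
    xs≈orbit++outside {b} = mk⇔ to from
      where
        to : b ∈ xs → b ∈ orbit a ++ outside
        to b∈xs with b ∈? orbit a
        ... | yes b∈orbit = Equivalence.from ++-∈⇔ (inj₁ b∈orbit)
        ... | no  b∉orbit = Equivalence.from ++-∈⇔ (inj₂ (∈-filter⁺ (_∉? orbit a) b∈xs b∉orbit))
        from : b ∈ orbit a ++ outside → b ∈ xs
        from b∈ with Equivalence.to ++-∈⇔ b∈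
        ... | inj₁ b∈orbit   = orbit⊆xs b∈orbit
        ... | inj₂ b∈outside = proj₁ (∈-outside⁻ b∈outside)

    length-outside : length xs ≡ 3 + length outside
    length-outside = unique∧set⇒length≡ unique
      (++⁺ (orbit-unique (fixedFree a∈xs)) (filter⁺ (_∉? orbit a) unique)
           (λ (b∈orbit , b∈outside) → proj₂ (∈-outside⁻ b∈outside) b∈orbit))
      xs≈orbit++outside

  3∣length : ∀ {xs} → FreeOrbits xs → 3 ∣ length xs
  3∣length inv = go inv (<-wellFounded _)
    where
      go : ∀ {xs} → FreeOrbits xs → Acc _<_ (length xs) → 3 ∣ length xs
      go {[]}     _   _         = 3 ∣0
      go {a ∷ xs} inv (acc rec) =
        subst (3 ∣_) (sym length≡) (∣m∣n⇒∣m+n ∣-refl (go (outside-freeOrbits inv a∈) (rec shorter)))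
        where
          a∈ : a ∈ a ∷ xs
          a∈ = here refl
          length≡ : length (a ∷ xs) ≡ 3 + length (outside inv a∈)
          length≡ = length-outside inv a∈
          shorter : length (outside inv a∈) < length (a ∷ xs)
          shorter = subst (length (outside inv a∈) <_) (sym length≡) (m<n+m _ (s≤s z≤n))

withPunchIn : ∀ {m} → Fin (suc m) × Fin m → Fin (suc m) × Fin (suc m)
withPunchIn (x , j) = x , punchIn x j

withPunchIn-injective : ∀ {m} → Injective _≡_ _≡_ (withPunchIn {m})
withPunchIn-injective {x = x , j} {y , k} eq with cong proj₁ eq
... | refl = cong (x ,_) (punchIn-injective x j k (cong proj₂ eq))

offDiagonal : ∀ m → List (Fin (suc m) × Fin (suc m))
offDiagonal m = map withPunchIn (cartesianProduct (allFin (suc m)) (allFin m))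

length-offDiagonal : ∀ m → length (offDiagonal m) ≡ suc m * m
length-offDiagonal m = begin
  length (offDiagonal m)
    ≡⟨ length-map withPunchIn (cartesianProduct (allFin (suc m)) (allFin m)) ⟩
  length (cartesianProduct (allFin (suc m)) (allFin m))
    ≡⟨ length-cartesianProduct (allFin (suc m)) (allFin m) ⟩
  length (allFin (suc m)) * length (allFin m)
    ≡⟨ cong₂ _*_ (length-tabulate {n = suc m} (λ i → i)) (length-tabulate {n = m} (λ i → i)) ⟩
  suc m * m
    ∎

offDiagonal-unique : ∀ m → Unique (offDiagonal m)
offDiagonal-unique m = unique-map⁺ withPunchIn-injective (cartesianProduct⁺ (allFin⁺ (suc m)) (allFin⁺ m))

∈-offDiagonal : ∀ {m} {x y : Fin (suc m)} → (x , y) ∈ offDiagonal m ⇔ x ≢ y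
∈-offDiagonal {m} {x} {y} = mk⇔ to from
  where
    to : (x , y) ∈ offDiagonal m → x ≢ y
    to xy∈ with ∈-map⁻ withPunchIn xy∈
    ... | (x , j) , _ , refl = λ x≡y → punchInᵢ≢i x j (sym x≡y)
    from : x ≢ y → (x , y) ∈ offDiagonal m
    from x≢y = subst (λ t → (x , t) ∈ offDiagonal m) (punchIn-punchOut x≢y)
      (∈-map⁺ withPunchIn (∈-cartesianProduct⁺ (∈-allFin x) (∈-allFin (punchOut x≢y))))

module Mendelsohn {m} (_∘_ : Op (suc m)) (idempotent : Idempotent _∘_)
                  (mendelsohn : ∀ x y → x ∘ (y ∘ x) ≡ y) where

  rotate : Fin (suc m) × Fin (suc m) → Fin (suc m) × Fin (suc m)
  rotate (x , y) = y , x ∘ y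

  rotate³≡id : ∀ xy → rotate (rotate (rotate xy)) ≡ xy
  rotate³≡id (x , y) = cong₂ _,_ (mendelsohn y x) (mendelsohn (x ∘ y) y)

  rotate-≢ : ∀ {x y} → x ≢ y → y ≢ x ∘ y
  rotate-≢ {x} {y} x≢y y≡x∘y = x≢y (begin
    x              ≡⟨ mendelsohn y x ⟨
    y ∘ (x ∘ y)    ≡⟨ cong (y ∘_) y≡x∘y ⟨
    y ∘ y          ≡⟨ idempotent y ⟩
    y              ∎)

  open OrderThree (≡-dec _≟_ _≟_) rotate rotate³≡id using (FreeOrbits; 3∣length)

  offDiagonal-freeOrbits : FreeOrbits (offDiagonal m)
  offDiagonal-freeOrbits = record
    { unique    = offDiagonal-unique m
    ; closed    = λ xy∈ → Equivalence.from ∈-offDiagonal (rotate-≢ (Equivalence.to ∈-offDiagonal xy∈))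
    ; fixedFree = λ xy∈ rotate≡ → Equivalence.to ∈-offDiagonal xy∈ (sym (cong proj₁ rotate≡))
    }

  3∣[1+m]*m : 3 ∣ suc m * m
  3∣[1+m]*m = subst (3 ∣_) (length-offDiagonal m) (3∣length offDiagonal-freeOrbits)

*-cong-% : ∀ m n {a b k} .{{_ : NonZero k}} → m % k ≡ a → n % k ≡ b → m * n % k ≡ a * b % k
*-cong-% m n {k = k} m%k≡a n%k≡b = trans (%-distribˡ-* m n k) (cong₂ (λ a b → a * b % k) m%k≡a n%k≡b)

^-odd-%3 : ∀ {p} → p % 3 ≡ 2 → ∀ d → d % 2 ≡ 1 → p ^ d % 3 ≡ 2
^-odd-%3     _     zero          ()
^-odd-%3 {p} p%3≡2 (suc zero)    _       = trans (cong (_% 3) (*-identityʳ p)) p%3≡2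
^-odd-%3 {p} p%3≡2 (suc (suc d)) d+2%2≡1 = *-cong-% p _ p%3≡2 (*-cong-% p (p ^ d) p%3≡2 (^-odd-%3 p%3≡2 d d%2≡1))
  where
    d%2≡1 : d % 2 ≡ 1
    d%2≡1 = trans (sym ([m+n]%n≡m%n d 2)) (trans (cong (_% 2) (+-comm d 2)) d+2%2≡1)

%3≡2⇒¬3∣[1+m]*m : ∀ m → suc m % 3 ≡ 2 → ¬ 3 ∣ suc m * m
%3≡2⇒¬3∣[1+m]*m m 1+m%3≡2 3∣ with euclidsLemma (suc m) m (from-yes (prime? 3)) 3∣
... | inj₁ 3∣1+m = 0≢2 (trans (sym (n∣m⇒m%n≡0 (suc m) 3 3∣1+m)) 1+m%3≡2)
  where
    0≢2 : 0 ≢ 2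
    0≢2 ()
... | inj₂ 3∣m   = 1≢2 (begin
  1                      ≡⟨⟩
  (1 % 3 + 0) % 3        ≡⟨ cong (λ r → (1 % 3 + r) % 3) (n∣m⇒m%n≡0 m 3 3∣m) ⟨
  (1 % 3 + m % 3) % 3    ≡⟨ %-distribˡ-+ 1 m 3 ⟨
  suc m % 3              ≡⟨ 1+m%3≡2 ⟩
  2                      ∎)
  where
    1≢2 : 1 ≢ 2
    1≢2 ()

%3≡2⇒¬Mendelsohn : ∀ n → n % 3 ≡ 2 → (_∘_ : Op n) → ¬ IsMendelsohnQuasigroup _∘_
%3≡2⇒¬Mendelsohn (suc m) n%3≡2 _∘_ (_ , idempotent , mendelsohn) =
  %3≡2⇒¬3∣[1+m]*m m n%3≡2 (Mendelsohn.3∣[1+m]*m _∘_ idempotent mendelsohn)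

lemma2p9 : (p d : ℕ) → Prime p → p % 3 ≡ 2 → (d % 2 ≡ 1) →
           (_∘_ : Op (p ^ d)) →
           ¬ (IsMendelsohnQuasigroup _∘_ × IsDistributive _∘_)
lemma2p9 p d _ p%3≡2 d%2≡1 _∘_ (isMendelsohn , _) =
  %3≡2⇒¬Mendelsohn (p ^ d) (^-odd-%3 p%3≡2 d d%2≡1) _∘_ isMendelsohn
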